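{- Let $D$ be a semi-regular bipartite simple digraph with bipartition $(V_1,V_2)$, where every vertex in $V_1$ has out-degree $r_1$ and every vertex in $V_2$ has out-degree $r_2$, and let $n_1=|V_1|$, $n_2=|V_2|$. Then (i) $\displaystyle \chi_{A(D)}(\lambda)=\frac{(n_1+n_2)\lambda+n_1r_{1}+n_2r_{2}}{\lambda^2-r_{1}r_{2}}$, (ii) $\displaystyle \chi_{Q(D)}(\lambda)=\frac{(n_1+n_2)\lambda+(n_1-n_2)(r_{1}-r_{2})}{\lambda(\lambda-(r_{1}+r_{2}))}$.
   Context: A digraph is bipartite if its underlying graph is bipartite (so every arc goes between $V_1$ and $V_2$); it is semi-regular bipartite if all vertices in $V_1$ have the same out-degree and all vertices in $V_2$ have the same out-degree. $A(D)$ is the adjacency matrix, $D_{\rm out}(D)$ the diagonal out-degree matrix and $Q(D)=D_{\rm out}(D)+A(D)$. For a real $n\times n$ matrix $M$ regarded over $\mathbb{C}(\lambda)$, the $M$-coronal is $\chi_M(\lambda)=\mathbf{1}_n^T(\lambda I_n-M)^{ -1}\mathbf{1}_n$, $\mathbf{1}_n$ the all-ones column vector. -}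

module Defs where

open import Data.Nat as ℕ using (ℕ; zero; suc)
open import Data.Integer as ℤ using (ℤ; +_; -_)
open import Data.Bool using (Bool; true; false; not; if_then_else_)
open import Data.Fin using (Fin) renaming (zero to fz; suc to fs)
open import Data.Fin.Properties using (_≟_)
open import Data.List using (List; []; _∷_)
open import Data.List.Relation.Unary.All using (All)
open import Data.Product using (Σ; _×_; _,_)
open import Relation.Nullary using (¬_; yes; no)
open import Relation.Binary.PropositionalEquality using (_≡_; _≢_)

sumFin : ∀ {A : Set} → (A → A → A) → A → ∀ n → (Fin n → A) → A
sumFin _⊕_ e zero    f = e
sumFin _⊕_ e (suc n) f = f fz ⊕ sumFin _⊕_ e n (λ i → f (fs i))

count : ∀ {n} → (Fin n → Bool) → ℕ
count {n} p = sumFin ℕ._+_ 0 n (λ i → if p i then 1 else 0)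

-- Polynomials in λ with integer coefficients (lowest degree first)

Poly : Set
Poly = List ℤ

_+ₚ_ : Poly → Poly → Poly
[]      +ₚ q       = q
(a ∷ p) +ₚ []      = a ∷ p
(a ∷ p) +ₚ (b ∷ q) = (a ℤ.+ b) ∷ (p +ₚ q)

scaleₚ : ℤ → Poly → Poly
scaleₚ c []      = []
scaleₚ c (a ∷ p) = (c ℤ.* a) ∷ scaleₚ c p

-ₚ_ : Poly → Poly
-ₚ p = scaleₚ (- (+ 1)) p

_*ₚ_ : Poly → Poly → Poly
[]      *ₚ q = []
(a ∷ p) *ₚ q = scaleₚ a q +ₚ (+ 0 ∷ (p *ₚ q))

infixl 6 _+ₚ_
infixl 7 _*ₚ_

IsZeroₚ : Poly → Set
IsZeroₚ p = All (_≡ + 0) p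

-- The field ℚ(λ) of rational functions, represented as fractions p/q of
-- integer polynomials.  Sums and products of valid fractions
-- are valid (ℤ[λ] is an integral domain), and on valid fractions '_≈ᶠ_'
-- is exactly equality in ℚ(λ).

record RatFun : Set where
  constructor _/_
  field
    num : Poly
    den : Poly
open RatFun public

Valid : RatFun → Set
Valid f = ¬ IsZeroₚ (den f)

_≈ᶠ_ : RatFun → RatFun → Set
f ≈ᶠ g = IsZeroₚ ((num f *ₚ den g) +ₚ (-ₚ (num g *ₚ den f)))

one : Poly
one = + 1 ∷ []

polyF : Poly → RatFun
polyF p = p / one

intF : ℤ → RatFun
intF c = polyF (c ∷ [])

natF : ℕ → RatFun
natF k = intF (+ k)

_+ᶠ_ : RatFun → RatFun → RatFun
f +ᶠ g = ((num f *ₚ den g) +ₚ (num g *ₚ den f)) / (den f *ₚ den g)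

_*ᶠ_ : RatFun → RatFun → RatFun
f *ᶠ g = (num f *ₚ num g) / (den f *ₚ den g)

-ᶠ_ : RatFun → RatFun
-ᶠ f = (-ₚ num f) / den f

-- division (meaningful when the divisor is a nonzero rational function)
_÷ᶠ_ : RatFun → RatFun → RatFun
f ÷ᶠ g = (num f *ₚ den g) / (den f *ₚ num g)

infixl 6 _+ᶠ_
infixl 7 _*ᶠ_ _÷ᶠ_
infix  8 -ᶠ_
infix  4 _≈ᶠ_

λF : RatFun
λF = polyF (+ 0 ∷ + 1 ∷ [])

Mat : Set → ℕ → Set
Mat A n = Fin n → Fin n → A

δ : ∀ {n} → Fin n → Fin n → Bool
δ i j with i ≟ j
... | yes _ = true
... | no  _ = false

Iᶠ : ∀ {n} → Mat RatFun n
Iᶠ i j = if δ i j then natF 1 else natF 0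

_·ᶠ_ : ∀ {n} → Mat RatFun n → Mat RatFun n → Mat RatFun n
_·ᶠ_ {n} M N i j = sumFin _+ᶠ_ (natF 0) n (λ k → M i k *ᶠ N k j)

_≈ᴹ_ : ∀ {n} → Mat RatFun n → Mat RatFun n → Set
M ≈ᴹ N = ∀ i j → M i j ≈ᶠ N i j

λI-_ : ∀ {n} → Mat ℤ n → Mat RatFun n
(λI- M) i j = (if δ i j then λF else natF 0) +ᶠ intF (- M i j)

sumAll : ∀ {n} → Mat RatFun n → RatFun
sumAll {n} N = sumFin _+ᶠ_ (natF 0) n (λ i → sumFin _+ᶠ_ (natF 0) n (λ j → N i j))

IsInverse : ∀ {n} → Mat RatFun n → Mat RatFun n → Set
IsInverse L N = (∀ i j → Valid (N i j)) × (L ·ᶠ N) ≈ᴹ Iᶠ × (N ·ᶠ L) ≈ᴹ Iᶠ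

-- χ_M(λ) = 1ᵀ (λI - M)⁻¹ 1 equals f : the inverse exists and 1ᵀ(λI-M)⁻¹1 ≈ f
CoronalIs : ∀ {n} → Mat ℤ n → RatFun → Set
CoronalIs {n} M f = Σ (Mat RatFun n) (λ N → IsInverse (λI- M) N × sumAll N ≈ᶠ f)

record SimpleDigraph (n : ℕ) : Set where
  field
    arc   : Fin n → Fin n → Bool      -- no multiple arcs
    loopless : ∀ i → arc i i ≡ false
open SimpleDigraph public

outdeg : ∀ {n} → SimpleDigraph n → Fin n → ℕ
outdeg D i = count (arc D i)

adjMat : ∀ {n} → SimpleDigraph n → Mat ℤ n
adjMat D i j = if arc D i j then + 1 else + 0

QMat : ∀ {n} → SimpleDigraph n → Mat ℤ n
QMat D i j = (if δ i j then + outdeg D i else + 0) ℤ.+ adjMat D i j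

-- bipartition given by side : Fin n → Bool  (V₁ = side true, V₂ = side false);
-- every arc goes between V₁ and V₂
IsBipartition : ∀ {n} → SimpleDigraph n → (Fin n → Bool) → Set
IsBipartition D side = ∀ i j → arc D i j ≡ true → side i ≢ side j

SemiRegular : ∀ {n} → SimpleDigraph n → (Fin n → Bool) → ℕ → ℕ → Set
SemiRegular D side r₁ r₂ =
  (∀ i → side i ≡ true → outdeg D i ≡ r₁) × (∀ i → side i ≡ false → outdeg D i ≡ r₂)

-- λI − M is invertible over ℚ(λ) for every integer matrix M: bordering by Schur complements
-- constructs, by induction on the size, a polynomial matrix P and a monic polynomial d with
-- (λI − M) P = P (λI − M) = d I.  Monic polynomials are not zero divisors, so d ≠ 0 and equality
-- of fractions by cross-multiplication can be chained through denominators like d.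
-- The coronal is then read off from any polynomial vector y with (λI − M) y = e 𝟙, e monic:
-- 𝟙ᵀ P 𝟙 · e = 𝟙ᵀ P (λI − M) y = d · 𝟙ᵀ y, hence χ_M = 𝟙ᵀ y / e.
-- In a semi-regular bipartite digraph every arc joins the two sides, so (A y)ₖ = rₖ · (value of y
-- on the side opposite to k) for y constant on V₁ and on V₂.  Taking y = λ + r₁ on V₁ and λ + r₂ on V₂
-- gives (λI − A) y = (λ² − r₁ r₂) 𝟙, and y = λ + r₁ − r₂ on V₁, λ + r₂ − r₁ on V₂ gives
-- (λI − Q) y = λ (λ − r₁ − r₂) 𝟙; summing y yields the numerators.

module Submission where

open import Defs
open import Algebra using (CommutativeRing)
open import Data.Bool using (Bool; true; false; if_then_else_; not)
open import Data.Empty using (⊥-elim)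
open import Data.Fin using (Fin) renaming (zero to fz; suc to fs)
open import Data.Fin.Properties using (_≟_; suc-injective)
open import Data.Integer as ℤ using (ℤ; +_; -_) renaming (_-_ to _-ℤ_; _*_ to _*ℤ_)
import Data.Integer.Properties as ℤP
open import Data.Integer.Tactic.RingSolver using (solve-∀)
open import Data.List using ([]; _∷_)
open import Data.List.Relation.Unary.All using ([]; _∷_)
open import Data.Maybe as Maybe using (Maybe; just; nothing)
open import Data.Nat as ℕ using (ℕ; zero; suc; _+_; _*_; _≤_; z≤n; s≤s)
import Data.Nat.Properties as ℕP
open import Data.Product using (Σ-syntax; _×_; _,_; proj₁; proj₂)
open import Data.Sum using (_⊎_; inj₁; inj₂)
open import Data.Vec.Functional using (Vector)
open import Function using (_$_)
open import Level using (0ℓ)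
open import Relation.Binary using (IsEquivalence; Setoid)
open import Relation.Binary.PropositionalEquality
  using (_≡_; _≢_; refl; sym; trans; cong; cong₂; subst; module ≡-Reasoning)
open import Relation.Nullary using (¬_; yes; no; contradiction)
open import Tactic.RingSolver.Core.AlmostCommutativeRing using (AlmostCommutativeRing; fromCommutativeRing)

coeff : Poly → ℕ → ℤ
coeff []      _       = + 0
coeff (a ∷ p) zero    = a
coeff (a ∷ p) (suc k) = coeff p k

infix 4 _≈ₚ_
record _≈ₚ_ (p q : Poly) : Set where
  constructor coeffwise
  field coeff-≡ : ∀ k → coeff p k ≡ coeff q k
open _≈ₚ_ public

≈ₚ-refl : ∀ {p} → p ≈ₚ p
≈ₚ-refl = coeffwise λ _ → refl

≈ₚ-sym : ∀ {p q} → p ≈ₚ q → q ≈ₚ p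
≈ₚ-sym e = coeffwise λ k → sym (coeff-≡ e k)

≈ₚ-trans : ∀ {p q r} → p ≈ₚ q → q ≈ₚ r → p ≈ₚ r
≈ₚ-trans e f = coeffwise λ k → trans (coeff-≡ e k) (coeff-≡ f k)

≈ₚ-isEquivalence : IsEquivalence _≈ₚ_
≈ₚ-isEquivalence = record { refl = ≈ₚ-refl ; sym = ≈ₚ-sym ; trans = ≈ₚ-trans }

≈ₚ-setoid : Setoid 0ℓ 0ℓ
≈ₚ-setoid = record { isEquivalence = ≈ₚ-isEquivalence }

≡⇒≈ₚ : ∀ {p q} → p ≡ q → p ≈ₚ q
≡⇒≈ₚ refl = ≈ₚ-refl

∷-cong : ∀ {a b p q} → a ≡ b → p ≈ₚ q → a ∷ p ≈ₚ b ∷ q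
∷-cong a≡b p≈q = coeffwise λ { zero → a≡b ; (suc k) → coeff-≡ p≈q k }

∷-injective : ∀ {a b p q} → a ∷ p ≈ₚ b ∷ q → a ≡ b × p ≈ₚ q
∷-injective e = coeff-≡ e zero , coeffwise λ k → coeff-≡ e (suc k)

shift : Poly → Poly
shift p = + 0 ∷ p

shift-[] : shift [] ≈ₚ []
shift-[] = coeffwise λ { zero → refl ; (suc k) → refl }

coeff-+ : ∀ p q k → coeff (p +ₚ q) k ≡ coeff p k ℤ.+ coeff q k
coeff-+ []      q       k       = sym (ℤP.+-identityˡ _)
coeff-+ (a ∷ p) []      k       = sym (ℤP.+-identityʳ _)
coeff-+ (a ∷ p) (b ∷ q) zero    = refl
coeff-+ (a ∷ p) (b ∷ q) (suc k) = coeff-+ p q k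

coeff-scale : ∀ c p k → coeff (scaleₚ c p) k ≡ c ℤ.* coeff p k
coeff-scale c []      k       = sym (ℤP.*-zeroʳ c)
coeff-scale c (a ∷ p) zero    = refl
coeff-scale c (a ∷ p) (suc k) = coeff-scale c p k

coeff-neg : ∀ p k → coeff (-ₚ p) k ≡ - coeff p k
coeff-neg p k = trans (coeff-scale _ p k) (ℤP.-1*i≡-i _)

+-cong : ∀ {p p′ q q′} → p ≈ₚ p′ → q ≈ₚ q′ → p +ₚ q ≈ₚ p′ +ₚ q′
+-cong {p} {p′} {q} {q′} e f = coeffwise λ k →
  trans (coeff-+ p q k) (trans (cong₂ ℤ._+_ (coeff-≡ e k) (coeff-≡ f k)) (sym (coeff-+ p′ q′ k)))

scale-cong : ∀ c {p q} → p ≈ₚ q → scaleₚ c p ≈ₚ scaleₚ c q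
scale-cong c {p} {q} e = coeffwise λ k →
  trans (coeff-scale c p k) (trans (cong (c ℤ.*_) (coeff-≡ e k)) (sym (coeff-scale c q k)))

+-comm : ∀ p q → p +ₚ q ≈ₚ q +ₚ p
+-comm p q = coeffwise λ k →
  trans (coeff-+ p q k) (trans (ℤP.+-comm (coeff p k) _) (sym (coeff-+ q p k)))

+-assoc : ∀ p q r → (p +ₚ q) +ₚ r ≈ₚ p +ₚ (q +ₚ r)
+-assoc p q r = coeffwise λ k → begin
  coeff ((p +ₚ q) +ₚ r) k                    ≡⟨ trans (coeff-+ (p +ₚ q) r k) (cong (ℤ._+ coeff r k) (coeff-+ p q k)) ⟩
  (coeff p k ℤ.+ coeff q k) ℤ.+ coeff r k   ≡⟨ ℤP.+-assoc (coeff p k) _ _ ⟩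
  coeff p k ℤ.+ (coeff q k ℤ.+ coeff r k)   ≡⟨ sym (trans (coeff-+ p (q +ₚ r) k) (cong (λ z → coeff p k ℤ.+ z) (coeff-+ q r k))) ⟩
  coeff (p +ₚ (q +ₚ r)) k                    ∎
  where open ≡-Reasoning

+-identityʳ : ∀ p → p +ₚ [] ≈ₚ p
+-identityʳ p = coeffwise λ k → trans (coeff-+ p [] k) (ℤP.+-identityʳ _)

-‿cong : ∀ {p q} → p ≈ₚ q → -ₚ p ≈ₚ -ₚ q
-‿cong = scale-cong _

-‿inverseˡ : ∀ p → (-ₚ p) +ₚ p ≈ₚ []
-‿inverseˡ p = coeffwise λ k →
  trans (coeff-+ (-ₚ p) p k) (trans (cong (ℤ._+ coeff p k) (coeff-neg p k)) (ℤP.+-inverseˡ (coeff p k)))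

-‿inverseʳ : ∀ p → p +ₚ (-ₚ p) ≈ₚ []
-‿inverseʳ p = ≈ₚ-trans (+-comm p (-ₚ p)) (-‿inverseˡ p)

+-interchange : ∀ p q r s → (p +ₚ q) +ₚ (r +ₚ s) ≈ₚ (p +ₚ r) +ₚ (q +ₚ s)
+-interchange p q r s = coeffwise λ k → begin
  coeff ((p +ₚ q) +ₚ (r +ₚ s)) k
    ≡⟨ trans (coeff-+ (p +ₚ q) (r +ₚ s) k) (cong₂ ℤ._+_ (coeff-+ p q k) (coeff-+ r s k)) ⟩
  (coeff p k ℤ.+ coeff q k) ℤ.+ (coeff r k ℤ.+ coeff s k)
    ≡⟨ interchange (coeff p k) (coeff q k) (coeff r k) (coeff s k) ⟩
  (coeff p k ℤ.+ coeff r k) ℤ.+ (coeff q k ℤ.+ coeff s k)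
    ≡⟨ sym (trans (coeff-+ (p +ₚ r) (q +ₚ s) k) (cong₂ ℤ._+_ (coeff-+ p r k) (coeff-+ q s k))) ⟩
  coeff ((p +ₚ r) +ₚ (q +ₚ s)) k ∎
  where
  open ≡-Reasoning
  interchange : ∀ w x y z → (w ℤ.+ x) ℤ.+ (y ℤ.+ z) ≡ (w ℤ.+ y) ℤ.+ (x ℤ.+ z)
  interchange = solve-∀

scale-distribˡ : ∀ c p q → scaleₚ c (p +ₚ q) ≈ₚ scaleₚ c p +ₚ scaleₚ c q
scale-distribˡ c p q = coeffwise λ k → begin
  coeff (scaleₚ c (p +ₚ q)) k               ≡⟨ trans (coeff-scale c (p +ₚ q) k) (cong (c ℤ.*_) (coeff-+ p q k)) ⟩
  c ℤ.* (coeff p k ℤ.+ coeff q k)          ≡⟨ ℤP.*-distribˡ-+ c _ _ ⟩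
  c ℤ.* coeff p k ℤ.+ c ℤ.* coeff q k      ≡⟨ sym (trans (coeff-+ (scaleₚ c p) _ k) (cong₂ ℤ._+_ (coeff-scale c p k) (coeff-scale c q k))) ⟩
  coeff (scaleₚ c p +ₚ scaleₚ c q) k        ∎
  where open ≡-Reasoning

scale-distribʳ : ∀ a b p → scaleₚ (a ℤ.+ b) p ≈ₚ scaleₚ a p +ₚ scaleₚ b p
scale-distribʳ a b p = coeffwise λ k → begin
  coeff (scaleₚ (a ℤ.+ b) p) k              ≡⟨ coeff-scale (a ℤ.+ b) p k ⟩
  (a ℤ.+ b) ℤ.* coeff p k                  ≡⟨ ℤP.*-distribʳ-+ _ a b ⟩
  a ℤ.* coeff p k ℤ.+ b ℤ.* coeff p k      ≡⟨ sym (trans (coeff-+ (scaleₚ a p) _ k) (cong₂ ℤ._+_ (coeff-scale a p k) (coeff-scale b p k))) ⟩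
  coeff (scaleₚ a p +ₚ scaleₚ b p) k        ∎
  where open ≡-Reasoning

scale-assoc : ∀ a b p → scaleₚ a (scaleₚ b p) ≈ₚ scaleₚ (a ℤ.* b) p
scale-assoc a b p = coeffwise λ k →
  trans (coeff-scale a (scaleₚ b p) k) (trans (cong (a ℤ.*_) (coeff-scale b p k))
    (trans (sym (ℤP.*-assoc a b _)) (sym (coeff-scale _ p k))))

scale-zero : ∀ p → scaleₚ (+ 0) p ≈ₚ []
scale-zero p = coeffwise (coeff-scale _ p)

scale-one : ∀ p → scaleₚ (+ 1) p ≈ₚ p
scale-one p = coeffwise λ k → trans (coeff-scale _ p k) (ℤP.*-identityˡ _)

scale-shift : ∀ c p → scaleₚ c (shift p) ≈ₚ shift (scaleₚ c p)
scale-shift c p = ∷-cong (ℤP.*-zeroʳ c) ≈ₚ-refl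

∷≈[] : ∀ {a p} → a ∷ p ≈ₚ [] → a ≡ + 0 × p ≈ₚ []
∷≈[] e = coeff-≡ e zero , coeffwise λ k → coeff-≡ e (suc k)

*-zeroˡ-≈ : ∀ {p} r → p ≈ₚ [] → p *ₚ r ≈ₚ []
*-zeroˡ-≈ {[]}    r e = ≈ₚ-refl
*-zeroˡ-≈ {a ∷ p} r e with ∷≈[] e
... | refl , p≈[] = ≈ₚ-trans (+-cong (scale-zero r) (∷-cong refl (*-zeroˡ-≈ r p≈[]))) shift-[]

*-zeroʳ : ∀ p → p *ₚ [] ≈ₚ []
*-zeroʳ []      = ≈ₚ-refl
*-zeroʳ (a ∷ p) = ≈ₚ-trans (∷-cong refl (*-zeroʳ p)) shift-[]

*-congˡ : ∀ {p q} r → p ≈ₚ q → p *ₚ r ≈ₚ q *ₚ r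
*-congˡ {[]}    {[]}    r e = ≈ₚ-refl
*-congˡ {[]}    {b ∷ q} r e = ≈ₚ-sym (*-zeroˡ-≈ r (≈ₚ-sym e))
*-congˡ {a ∷ p} {[]}    r e = *-zeroˡ-≈ r e
*-congˡ {a ∷ p} {b ∷ q} r e with ∷-injective e
... | refl , p≈q = +-cong ≈ₚ-refl (∷-cong refl (*-congˡ r p≈q))

*-congʳ : ∀ p {q r} → q ≈ₚ r → p *ₚ q ≈ₚ p *ₚ r
*-congʳ []      e = ≈ₚ-refl
*-congʳ (a ∷ p) e = +-cong (scale-cong a e) (∷-cong refl (*-congʳ p e))

*-cong : ∀ {p p′ q q′} → p ≈ₚ p′ → q ≈ₚ q′ → p *ₚ q ≈ₚ p′ *ₚ q′
*-cong {p} {p′} {q} {q′} e f = ≈ₚ-trans (*-congˡ q e) (*-congʳ p′ f)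

*-distribʳ : ∀ r p q → (p +ₚ q) *ₚ r ≈ₚ p *ₚ r +ₚ q *ₚ r
*-distribʳ r []      q       = ≈ₚ-refl
*-distribʳ r (a ∷ p) []      = ≈ₚ-sym (+-identityʳ _)
*-distribʳ r (a ∷ p) (b ∷ q) =
  ≈ₚ-trans (+-cong (scale-distribʳ a b r) (∷-cong refl (*-distribʳ r p q)))
           (+-interchange (scaleₚ a r) (scaleₚ b r) (shift (p *ₚ r)) (shift (q *ₚ r)))

*-distribˡ : ∀ p q r → p *ₚ (q +ₚ r) ≈ₚ p *ₚ q +ₚ p *ₚ r
*-distribˡ []      q r = ≈ₚ-refl
*-distribˡ (a ∷ p) q r =
  ≈ₚ-trans (+-cong (scale-distribˡ a q r) (∷-cong refl (*-distribˡ p q r)))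
           (+-interchange (scaleₚ a q) (scaleₚ a r) (shift (p *ₚ q)) (shift (p *ₚ r)))

scale-*ˡ : ∀ c p q → scaleₚ c (p *ₚ q) ≈ₚ scaleₚ c p *ₚ q
scale-*ˡ c []      q = ≈ₚ-refl
scale-*ˡ c (a ∷ p) q =
  ≈ₚ-trans (scale-distribˡ c (scaleₚ a q) (shift (p *ₚ q)))
           (+-cong (scale-assoc c a q) (≈ₚ-trans (scale-shift c (p *ₚ q)) (∷-cong refl (scale-*ˡ c p q))))

*-scaleʳ : ∀ p c q → p *ₚ scaleₚ c q ≈ₚ scaleₚ c (p *ₚ q)
*-scaleʳ []      c q = ≈ₚ-refl
*-scaleʳ (a ∷ p) c q = ≈ₚ-trans
  (+-cong (≈ₚ-trans (scale-assoc a c q) (≈ₚ-trans (≡⇒≈ₚ (cong (λ x → scaleₚ x q) (ℤP.*-comm a c))) (≈ₚ-sym (scale-assoc c a q))))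
          (≈ₚ-trans (∷-cong refl (*-scaleʳ p c q)) (≈ₚ-sym (scale-shift c (p *ₚ q)))))
  (≈ₚ-sym (scale-distribˡ c (scaleₚ a q) (shift (p *ₚ q))))

shift-*ˡ : ∀ p q → shift p *ₚ q ≈ₚ shift (p *ₚ q)
shift-*ˡ p q = +-cong (scale-zero q) ≈ₚ-refl

*-shiftʳ : ∀ p q → p *ₚ shift q ≈ₚ shift (p *ₚ q)
*-shiftʳ []      q = ≈ₚ-sym shift-[]
*-shiftʳ (a ∷ p) q = ∷-cong (trans (ℤP.+-identityʳ _) (ℤP.*-zeroʳ a)) (+-cong ≈ₚ-refl (*-shiftʳ p q))

*-identityˡ : ∀ p → one *ₚ p ≈ₚ p
*-identityˡ p = ≈ₚ-trans (+-cong (scale-one p) shift-[]) (+-identityʳ p)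

*-identityʳ : ∀ p → p *ₚ one ≈ₚ p
*-identityʳ []      = ≈ₚ-refl
*-identityʳ (a ∷ p) = ∷-cong (trans (ℤP.+-identityʳ _) (ℤP.*-identityʳ a)) (*-identityʳ p)

*-comm : ∀ p q → p *ₚ q ≈ₚ q *ₚ p
*-comm []      q = ≈ₚ-sym (*-zeroʳ q)
*-comm (a ∷ p) q = ≈ₚ-sym (begin
  q *ₚ (a ∷ p)                        ≈⟨ *-congʳ q (∷-cong (sym (trans (ℤP.+-identityʳ _) (ℤP.*-identityʳ a))) ≈ₚ-refl) ⟩
  q *ₚ (scaleₚ a one +ₚ shift p)      ≈⟨ *-distribˡ q _ _ ⟩
  q *ₚ scaleₚ a one +ₚ q *ₚ shift p   ≈⟨ +-cong (≈ₚ-trans (*-scaleʳ q a one) (scale-cong a (*-identityʳ q)))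
                                                (≈ₚ-trans (*-shiftʳ q p) (∷-cong refl (*-comm q p))) ⟩
  scaleₚ a q +ₚ shift (p *ₚ q)        ∎)
  where open import Relation.Binary.Reasoning.Setoid ≈ₚ-setoid

*-assoc : ∀ p q r → (p *ₚ q) *ₚ r ≈ₚ p *ₚ (q *ₚ r)
*-assoc []      q r = ≈ₚ-refl
*-assoc (a ∷ p) q r =
  ≈ₚ-trans (*-distribʳ r (scaleₚ a q) (shift (p *ₚ q)))
           (+-cong (≈ₚ-sym (scale-*ˡ a q r)) (≈ₚ-trans (shift-*ˡ (p *ₚ q) r) (∷-cong refl (*-assoc p q r))))

ℤ[λ] : CommutativeRing 0ℓ 0ℓ
ℤ[λ] = record
  { Carrier = Poly ; _≈_ = _≈ₚ_ ; _+_ = _+ₚ_ ; _*_ = _*ₚ_ ; -_ = -ₚ_ ; 0# = [] ; 1# = one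
  ; isCommutativeRing = record
    { isRing = record
      { +-isAbelianGroup = record
        { isGroup = record
          { isMonoid = record
            { isSemigroup = record
              { isMagma = record
                { isEquivalence = ≈ₚ-isEquivalence
                ; ∙-cong = +-cong }
              ; assoc = +-assoc }
            ; identity = (λ _ → ≈ₚ-refl) , +-identityʳ }
          ; inverse = -‿inverseˡ , -‿inverseʳ
          ; ⁻¹-cong = -‿cong }
        ; comm = +-comm }
      ; *-cong = *-cong
      ; *-assoc = *-assoc
      ; *-identity = *-identityˡ , *-identityʳ
      ; distrib = *-distribˡ , *-distribʳ }
    ; *-comm = *-comm } }

ℤ[λ]-solver : AlmostCommutativeRing 0ℓ 0ℓ
ℤ[λ]-solver = fromCommutativeRing ℤ[λ] []≟_
  where
  []≟_ : ∀ p → Maybe ([] ≈ₚ p)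
  []≟ []        = just ≈ₚ-refl
  []≟ (+ 0 ∷ p) = Maybe.map (λ e → ≈ₚ-trans (≈ₚ-sym shift-[]) (∷-cong refl e)) ([]≟ p)
  []≟ (_ ∷ _)   = nothing


open import Tactic.RingSolver.NonReflective ℤ[λ]-solver using (solve; _⊕_; _⊗_; ⊝_; _⊜_; Κ)
open import Algebra.Properties.Semiring.Sum (CommutativeRing.semiring ℤ[λ])
  using (sum; sum-cong-≋; ∑-distrib-+; ∑-comm; *-distribˡ-sum; *-distribʳ-sum; sum-replicate-zero)

X : Poly
X = + 0 ∷ + 1 ∷ []

C : ℤ → Poly
C a = a ∷ []

C-* : ∀ a b → C (a ℤ.* b) ≈ₚ C a *ₚ C b
C-* a b = ∷-cong (sym (ℤP.+-identityʳ (a ℤ.* b))) ≈ₚ-refl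

C-neg : ∀ a → C (- a) ≈ₚ -ₚ C a
C-neg a = ∷-cong (sym (ℤP.-1*i≡-i a)) ≈ₚ-refl

C-zero : ∀ p → C (+ 0) *ₚ p ≈ₚ []
C-zero p = *-zeroˡ-≈ {C (+ 0)} p (coeffwise λ { zero → refl ; (suc k) → refl })

C-ℕ-* : ∀ m n → C (+ (m * n)) ≈ₚ C (+ m) *ₚ C (+ n)
C-ℕ-* m n = ≈ₚ-trans (≡⇒≈ₚ (cong C (ℤP.pos-* m n))) (C-* (+ m) (+ n))

C-sub : ∀ a b → C (a -ℤ b) ≈ₚ C a +ₚ (-ₚ C b)
C-sub a b = +-cong (≈ₚ-refl {C a}) (C-neg b)

record DegreeBelow (k : ℕ) (p : Poly) : Set where
  constructor degreeBelow
  field vanishes : ∀ j → k ≤ j → coeff p j ≡ + 0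
open DegreeBelow public

degreeBelow-cong : ∀ {k p q} → p ≈ₚ q → DegreeBelow k p → DegreeBelow k q
degreeBelow-cong e d = degreeBelow λ j k≤j → trans (sym (coeff-≡ e j)) (vanishes d j k≤j)

degreeBelow-mono : ∀ {k l p} → k ≤ l → DegreeBelow k p → DegreeBelow l p
degreeBelow-mono k≤l d = degreeBelow λ j l≤j → vanishes d j (ℕP.≤-trans k≤l l≤j)

degreeBelow-+ : ∀ {k p q} → DegreeBelow k p → DegreeBelow k q → DegreeBelow k (p +ₚ q)
degreeBelow-+ {p = p} {q} dp dq = degreeBelow λ j k≤j →
  trans (coeff-+ p q j) (cong₂ ℤ._+_ (vanishes dp j k≤j) (vanishes dq j k≤j))

degreeBelow-scale : ∀ {k} c p → DegreeBelow k p → DegreeBelow k (scaleₚ c p)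
degreeBelow-scale c p dp = degreeBelow λ j k≤j →
  trans (coeff-scale c p j) (trans (cong (c ℤ.*_) (vanishes dp j k≤j)) (ℤP.*-zeroʳ c))

degreeBelow-const : ∀ a → DegreeBelow 1 (a ∷ [])
degreeBelow-const a = degreeBelow λ { (suc j) _ → refl }

degreeBelow-zero : ∀ {p} → DegreeBelow 0 p → p ≈ₚ []
degreeBelow-zero d = coeffwise λ j → vanishes d j z≤n

degreeBelow-tail : ∀ {k a p} → DegreeBelow (suc k) (a ∷ p) → DegreeBelow k p
degreeBelow-tail d = degreeBelow λ j k≤j → vanishes d (suc j) (s≤s k≤j)

degreeBelow-* : ∀ {k l} p q → DegreeBelow k p → DegreeBelow (suc l) q → DegreeBelow (k + l) (p *ₚ q)
degreeBelow-* {zero}  p       q dp dq = degreeBelow-cong (≈ₚ-sym (*-zeroˡ-≈ q (degreeBelow-zero dp))) (degreeBelow λ _ _ → refl)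
degreeBelow-* {suc k} []      q dp dq = degreeBelow λ _ _ → refl
degreeBelow-* {suc k} {l} (a ∷ p) q dp dq = degreeBelow λ
  { zero () ; (suc j) (s≤s k+l≤j) → begin
      coeff (scaleₚ a q +ₚ shift (p *ₚ q)) (suc j)   ≡⟨ coeff-+ (scaleₚ a q) _ (suc j) ⟩
      coeff (scaleₚ a q) (suc j) ℤ.+ coeff (p *ₚ q) j
        ≡⟨ cong₂ ℤ._+_ (vanishes (degreeBelow-scale a q dq) (suc j) (s≤s (ℕP.≤-trans (ℕP.m≤n+m l k) k+l≤j)))
                       (vanishes (degreeBelow-* p q (degreeBelow-tail dp) dq) j k+l≤j) ⟩
      + 0                                            ∎ }
  where open ≡-Reasoning

coeff-*-top : ∀ k l p q → DegreeBelow (suc k) p → DegreeBelow (suc l) q →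
              coeff (p *ₚ q) (k + l) ≡ coeff p k ℤ.* coeff q l
coeff-*-top k       l []      q dp dq = refl
coeff-*-top zero    l (a ∷ p) q dp dq = begin
  coeff (scaleₚ a q +ₚ shift (p *ₚ q)) l              ≡⟨ coeff-+ (scaleₚ a q) _ l ⟩
  coeff (scaleₚ a q) l ℤ.+ coeff (shift (p *ₚ q)) l   ≡⟨ cong₂ ℤ._+_ (coeff-scale a q l) (coeff-≡ pq≈[] l) ⟩
  a ℤ.* coeff q l ℤ.+ + 0                             ≡⟨ ℤP.+-identityʳ _ ⟩
  a ℤ.* coeff q l                                     ∎
  where
  open ≡-Reasoning
  pq≈[] : shift (p *ₚ q) ≈ₚ []
  pq≈[] = ≈ₚ-trans (∷-cong refl (*-zeroˡ-≈ q (degreeBelow-zero (degreeBelow-tail dp)))) shift-[]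
coeff-*-top (suc k) l (a ∷ p) q dp dq = begin
  coeff (scaleₚ a q +ₚ shift (p *ₚ q)) (suc (k + l))       ≡⟨ coeff-+ (scaleₚ a q) _ (suc (k + l)) ⟩
  coeff (scaleₚ a q) (suc (k + l)) ℤ.+ coeff (p *ₚ q) (k + l)
    ≡⟨ cong₂ ℤ._+_ (vanishes (degreeBelow-scale a q dq) _ (s≤s (ℕP.m≤n+m l k)))
                   (coeff-*-top k l p q (degreeBelow-tail dp) dq) ⟩
  + 0 ℤ.+ coeff p k ℤ.* coeff q l                            ≡⟨ ℤP.+-identityˡ _ ⟩
  coeff p k ℤ.* coeff q l                                    ∎
  where open ≡-Reasoning

Monic : ℕ → Poly → Set
Monic k p = coeff p k ≡ + 1 × DegreeBelow (suc k) p

monic-cong : ∀ {k p q} → p ≈ₚ q → Monic k p → Monic k q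
monic-cong e (lead , dp) = trans (sym (coeff-≡ e _)) lead , degreeBelow-cong e dp

monic-* : ∀ {k l p q} → Monic k p → Monic l q → Monic (k + l) (p *ₚ q)
monic-* {k} {l} {p} {q} (lp , dp) (lq , dq) =
  trans (coeff-*-top k l p q dp dq) (cong₂ ℤ._*_ lp lq) , degreeBelow-* p q dp dq

monic-+ : ∀ {k p q} → Monic k p → DegreeBelow k q → Monic k (p +ₚ q)
monic-+ {k} {p} {q} (lp , dp) dq =
  trans (coeff-+ p q k) (cong₂ ℤ._+_ lp (vanishes dq k ℕP.≤-refl)) ,
  degreeBelow-+ dp (degreeBelow-mono (ℕP.n≤1+n k) dq)

monic-sub : ∀ {k p q} → Monic k p → DegreeBelow k q → Monic k (p +ₚ (-ₚ q))
monic-sub {q = q} mp dq = monic-+ mp (degreeBelow-scale _ q dq)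

≈[]⇒IsZeroₚ : ∀ {p} → p ≈ₚ [] → IsZeroₚ p
≈[]⇒IsZeroₚ {[]}    e = []
≈[]⇒IsZeroₚ {a ∷ p} e = proj₁ (∷≈[] e) ∷ ≈[]⇒IsZeroₚ (proj₂ (∷≈[] e))

IsZeroₚ⇒≈[] : ∀ {p} → IsZeroₚ p → p ≈ₚ []
IsZeroₚ⇒≈[] []       = ≈ₚ-refl
IsZeroₚ⇒≈[] (z ∷ zs) = coeffwise λ { zero → z ; (suc k) → coeff-≡ (IsZeroₚ⇒≈[] zs) k }

monic⇒nonzero : ∀ {k p} → Monic k p → ¬ IsZeroₚ p
monic⇒nonzero {k} (lead , _) z with trans (sym lead) (coeff-≡ (IsZeroₚ⇒≈[] z) k)
... | ()

zero-or-leading : ∀ p → p ≈ₚ [] ⊎ Σ[ k ∈ ℕ ] coeff p k ≢ + 0 × DegreeBelow (suc k) p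
zero-or-leading []      = inj₁ ≈ₚ-refl
zero-or-leading (a ∷ p) with zero-or-leading p
... | inj₂ (k , lead≢0 , dp) = inj₂ (suc k , lead≢0 , degreeBelow λ { (suc j) (s≤s k≤j) → vanishes dp j k≤j })
... | inj₁ p≈[] with a ℤP.≟ + 0
...   | yes refl = inj₁ (≈ₚ-trans (∷-cong refl p≈[]) shift-[])
...   | no a≢0   = inj₂ (zero , a≢0 , degreeBelow λ { (suc j) _ → coeff-≡ p≈[] j })

monic-cancelʳ-zero : ∀ {m d} x → Monic m d → x *ₚ d ≈ₚ [] → x ≈ₚ []
monic-cancelʳ-zero {m} {d} x (lead , dd) xd≈[] with zero-or-leading x
... | inj₁ x≈[]             = x≈[]
... | inj₂ (k , lead≢0 , dx) = ⊥-elim (lead≢0 (begin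
  coeff x k                     ≡⟨ sym (ℤP.*-identityʳ _) ⟩
  coeff x k ℤ.* + 1             ≡⟨ cong (coeff x k ℤ.*_) (sym lead) ⟩
  coeff x k ℤ.* coeff d m       ≡⟨ sym (coeff-*-top k m x d dx dd) ⟩
  coeff (x *ₚ d) (k + m)      ≡⟨ coeff-≡ xd≈[] (k + m) ⟩
  + 0                           ∎))
  where open ≡-Reasoning

monic-cancelʳ : ∀ {m d} x y → Monic m d → x *ₚ d ≈ₚ y *ₚ d → x ≈ₚ y
monic-cancelʳ {d = d} x y md xd≈yd = begin
  x                            ≈⟨ solve 2 (λ x y → x ⊜ (x ⊕ ⊝ y ⊕ y)) ≈ₚ-refl x y ⟩
  (x +ₚ (-ₚ y)) +ₚ y           ≈⟨ +-cong x-y≈[] ≈ₚ-refl ⟩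
  y                            ∎
  where
  open import Relation.Binary.Reasoning.Setoid ≈ₚ-setoid
  x-y≈[] : x +ₚ (-ₚ y) ≈ₚ []
  x-y≈[] = monic-cancelʳ-zero (x +ₚ (-ₚ y)) md (begin
    (x +ₚ (-ₚ y)) *ₚ d           ≈⟨ solve 3 (λ x y d → (x ⊕ ⊝ y) ⊗ d ⊜ (x ⊗ d ⊕ ⊝ (y ⊗ d))) ≈ₚ-refl x y d ⟩
    x *ₚ d +ₚ (-ₚ (y *ₚ d))      ≈⟨ +-cong xd≈yd ≈ₚ-refl ⟩
    y *ₚ d +ₚ (-ₚ (y *ₚ d))      ≈⟨ -‿inverseʳ (y *ₚ d) ⟩
    []                           ∎)

degreeBelow-sum : ∀ {k n} (f : Vector Poly n) → (∀ i → DegreeBelow k (f i)) → DegreeBelow k (sum f)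
degreeBelow-sum {n = zero}  f df = degreeBelow λ _ _ → refl
degreeBelow-sum {n = suc n} f df = degreeBelow-+ (df fz) (degreeBelow-sum (λ i → f (fs i)) (λ i → df (fs i)))

degreeBelow-*-constʳ : ∀ {k} p c → DegreeBelow k p → DegreeBelow 1 c → DegreeBelow k (p *ₚ c)
degreeBelow-*-constʳ {k} p c dp dc = subst (λ m → DegreeBelow m (p *ₚ c)) (ℕP.+-identityʳ k) (degreeBelow-* p c dp dc)

degreeBelow-*-constˡ : ∀ {k} c p → DegreeBelow 1 c → DegreeBelow k p → DegreeBelow k (c *ₚ p)
degreeBelow-*-constˡ c p dc dp = degreeBelow-cong (*-comm p c) (degreeBelow-*-constʳ p c dp dc)

X-monic : Monic 1 X
X-monic = refl , degreeBelow λ { (suc (suc j)) _ → refl ; (suc zero) (s≤s ()) }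

open import Relation.Binary.Reasoning.Setoid ≈ₚ-setoid

infixl 7 _⋅_ _·ᵥ_ _ᵥ·_ _·ₘ_
infix  4 _≈ₘ_

_⋅_ : ∀ {n} → Vector Poly n → Vector Poly n → Poly
x ⋅ y = sum λ k → x k *ₚ y k

_·ᵥ_ : ∀ {n} → Mat Poly n → Vector Poly n → Vector Poly n
(A ·ᵥ y) i = A i ⋅ y

_ᵥ·_ : ∀ {n} → Vector Poly n → Mat Poly n → Vector Poly n
(x ᵥ· A) j = x ⋅ λ k → A k j

_·ₘ_ : ∀ {n} → Mat Poly n → Mat Poly n → Mat Poly n
(A ·ₘ B) i j = A i ⋅ λ k → B k j

_≈ₘ_ : ∀ {n} → Mat Poly n → Mat Poly n → Set
A ≈ₘ B = ∀ i j → A i j ≈ₚ B i j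

-- d · I, by recursion on the indices rather than through δ, so that its minors are scalarₘ d again definitionally
scalarₘ : ∀ {n} → Poly → Mat Poly n
scalarₘ d fz     fz     = d
scalarₘ d fz     (fs j) = []
scalarₘ d (fs i) fz     = []
scalarₘ d (fs i) (fs j) = scalarₘ d i j

⋅-cong : ∀ {n} {x x′ y y′ : Vector Poly n} → (∀ k → x k ≈ₚ x′ k) → (∀ k → y k ≈ₚ y′ k) → x ⋅ y ≈ₚ x′ ⋅ y′
⋅-cong x≈x′ y≈y′ = sum-cong-≋ λ k → *-cong (x≈x′ k) (y≈y′ k)

⋅-congʳ : ∀ {n} (x : Vector Poly n) {y y′} → (∀ k → y k ≈ₚ y′ k) → x ⋅ y ≈ₚ x ⋅ y′
⋅-congʳ x = ⋅-cong {x = x} (λ _ → ≈ₚ-refl)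

⋅-assoc : ∀ {n} (x : Vector Poly n) A y → (x ᵥ· A) ⋅ y ≈ₚ x ⋅ (A ·ᵥ y)
⋅-assoc x A y = begin
  (sum λ k → (sum λ l → x l *ₚ A l k) *ₚ y k)     ≈⟨ sum-cong-≋ (λ k → *-distribʳ-sum (y k) (λ l → x l *ₚ A l k)) ⟩
  (sum λ k → sum λ l → (x l *ₚ A l k) *ₚ y k)    ≈⟨ ∑-comm (λ k l → (x l *ₚ A l k) *ₚ y k) ⟩
  (sum λ l → sum λ k → (x l *ₚ A l k) *ₚ y k)    ≈⟨ sum-cong-≋ (λ l → sum-cong-≋ λ k → *-assoc (x l) (A l k) (y k)) ⟩
  (sum λ l → sum λ k → x l *ₚ (A l k *ₚ y k))    ≈⟨ sum-cong-≋ (λ l → ≈ₚ-sym (*-distribˡ-sum (x l) (λ k → A l k *ₚ y k))) ⟩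
  (sum λ l → x l *ₚ (sum λ k → A l k *ₚ y k))    ∎

scalarₘ-·ᵥ : ∀ {n} d (y : Vector Poly n) i → (scalarₘ d ·ᵥ y) i ≈ₚ d *ₚ y i
scalarₘ-·ᵥ {suc n} d y fz     = ≈ₚ-trans (+-cong ≈ₚ-refl (sum-replicate-zero n)) (+-identityʳ _)
scalarₘ-·ᵥ {suc n} d y (fs i) = scalarₘ-·ᵥ d (λ k → y (fs k)) i

ᵥ·-scalarₘ : ∀ {n} d (x : Vector Poly n) j → (x ᵥ· scalarₘ d) j ≈ₚ x j *ₚ d
ᵥ·-scalarₘ {suc n} d x fz     =
  ≈ₚ-trans (+-cong ≈ₚ-refl (≈ₚ-trans (sum-cong-≋ λ k → *-zeroʳ (x (fs k))) (sum-replicate-zero n))) (+-identityʳ _)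
ᵥ·-scalarₘ {suc n} d x (fs j) = ≈ₚ-trans (+-cong (*-zeroʳ (x fz)) ≈ₚ-refl) (ᵥ·-scalarₘ d (λ k → x (fs k)) j)

scalarₘ-*ʳ : ∀ {n} d e (i j : Fin n) → scalarₘ d i j *ₚ e ≈ₚ scalarₘ (d *ₚ e) i j
scalarₘ-*ʳ d e fz     fz     = ≈ₚ-refl
scalarₘ-*ʳ d e fz     (fs j) = ≈ₚ-refl
scalarₘ-*ʳ d e (fs i) fz     = ≈ₚ-refl
scalarₘ-*ʳ d e (fs i) (fs j) = scalarₘ-*ʳ d e i j

⋅-*ʳ : ∀ {n} (x y : Vector Poly n) c → x ⋅ (λ k → c *ₚ y k) ≈ₚ c *ₚ (x ⋅ y)
⋅-*ʳ x y c = begin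
  (sum λ k → x k *ₚ (c *ₚ y k))   ≈⟨ sum-cong-≋ (λ k → solve 3 (λ x c y → x ⊗ (c ⊗ y) ⊜ c ⊗ (x ⊗ y)) ≈ₚ-refl (x k) c (y k)) ⟩
  (sum λ k → c *ₚ (x k *ₚ y k))   ≈⟨ ≈ₚ-sym (*-distribˡ-sum c (λ k → x k *ₚ y k)) ⟩
  c *ₚ (x ⋅ y)                    ∎

*-⋅ : ∀ {n} (x y : Vector Poly n) c → (λ k → c *ₚ x k) ⋅ y ≈ₚ c *ₚ (x ⋅ y)
*-⋅ x y c = begin
  (sum λ k → (c *ₚ x k) *ₚ y k)   ≈⟨ sum-cong-≋ (λ k → *-assoc c (x k) (y k)) ⟩
  (sum λ k → c *ₚ (x k *ₚ y k))   ≈⟨ ≈ₚ-sym (*-distribˡ-sum c (λ k → x k *ₚ y k)) ⟩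
  c *ₚ (x ⋅ y)                    ∎

⋅-linearʳ : ∀ {n} (x y z : Vector Poly n) c c′ →
            x ⋅ (λ k → y k *ₚ c +ₚ z k *ₚ c′) ≈ₚ (x ⋅ y) *ₚ c +ₚ (x ⋅ z) *ₚ c′
⋅-linearʳ x y z c c′ = begin
  (sum λ k → x k *ₚ (y k *ₚ c +ₚ z k *ₚ c′))
    ≈⟨ sum-cong-≋ (λ k → solve 5 (λ x y z c c′ → x ⊗ (y ⊗ c ⊕ z ⊗ c′) ⊜ (x ⊗ y ⊗ c ⊕ x ⊗ z ⊗ c′))
                                  ≈ₚ-refl (x k) (y k) (z k) c c′) ⟩
  (sum λ k → (x k *ₚ y k) *ₚ c +ₚ (x k *ₚ z k) *ₚ c′)
    ≈⟨ ∑-distrib-+ (λ k → (x k *ₚ y k) *ₚ c) (λ k → (x k *ₚ z k) *ₚ c′) ⟩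
  (sum λ k → (x k *ₚ y k) *ₚ c) +ₚ (sum λ k → (x k *ₚ z k) *ₚ c′)
    ≈⟨ ≈ₚ-sym (+-cong (*-distribʳ-sum c (λ k → x k *ₚ y k)) (*-distribʳ-sum c′ (λ k → x k *ₚ z k))) ⟩
  (x ⋅ y) *ₚ c +ₚ (x ⋅ z) *ₚ c′
    ∎

⋅-linearˡ : ∀ {n} (x y z : Vector Poly n) c c′ →
            (λ k → y k *ₚ c +ₚ c′ *ₚ z k) ⋅ x ≈ₚ (y ⋅ x) *ₚ c +ₚ c′ *ₚ (z ⋅ x)
⋅-linearˡ x y z c c′ = begin
  (sum λ k → (y k *ₚ c +ₚ c′ *ₚ z k) *ₚ x k)
    ≈⟨ sum-cong-≋ (λ k → solve 5 (λ x y z c c′ → (y ⊗ c ⊕ c′ ⊗ z) ⊗ x ⊜ (y ⊗ x ⊗ c ⊕ c′ ⊗ (z ⊗ x)))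
                                  ≈ₚ-refl (x k) (y k) (z k) c c′) ⟩
  (sum λ k → (y k *ₚ x k) *ₚ c +ₚ c′ *ₚ (z k *ₚ x k))
    ≈⟨ ∑-distrib-+ (λ k → (y k *ₚ x k) *ₚ c) (λ k → c′ *ₚ (z k *ₚ x k)) ⟩
  (sum λ k → (y k *ₚ x k) *ₚ c) +ₚ (sum λ k → c′ *ₚ (z k *ₚ x k))
    ≈⟨ ≈ₚ-sym (+-cong (*-distribʳ-sum c (λ k → y k *ₚ x k)) (*-distribˡ-sum c′ (λ k → z k *ₚ x k))) ⟩
  (y ⋅ x) *ₚ c +ₚ c′ *ₚ (z ⋅ x)
    ∎

-- the shape of λI - M for an integer matrix M
record Characteristic {n} (L : Mat Poly n) : Set where
  field
    diagonal    : ∀ i → Monic 1 (L i i)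
    offDiagonal : ∀ {i j} → i ≢ j → DegreeBelow 1 (L i j)
open Characteristic

minor : ∀ {n} → Mat Poly (suc n) → Mat Poly n
minor L i j = L (fs i) (fs j)

characteristic-minor : ∀ {n} {L : Mat Poly (suc n)} → Characteristic L → Characteristic (minor L)
characteristic-minor χ = record
  { diagonal    = λ i → diagonal χ (fs i)
  ; offDiagonal = λ i≢j → offDiagonal χ (λ e → i≢j (suc-injective e)) }

record ScaledInverse {n} (L : Mat Poly n) : Set where
  field
    degree      : ℕ
    scale       : Poly
    adj         : Mat Poly n
    scale-monic : Monic degree scale
    adj-degree  : ∀ i j → DegreeBelow degree (adj i j)
    adj-right   : L ·ₘ adj ≈ₘ scalarₘ scale
    adj-left    : adj ·ₘ L ≈ₘ scalarₘ scale

-- Bordering by the Schur complement: for L = [[a, b], [c, L′]] with L′ P′ = P′ L′ = d′ I, the matrix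
-- P = [[d′², -d′ (b P′)], [-d′ (P′ c), P′ D + (P′ c)(b P′)]] with D = a d′ - b P′ c
-- satisfies L P = P L = d′ D I, and D is monic because a is monic of degree 1 while b P′ c has degree below that of d′.
module Bordering {n} (L : Mat Poly (suc n)) (χ : Characteristic L) (I′ : ScaledInverse (minor L)) where
  open ScaledInverse I′ using () renaming
    (degree to m′; scale to d′; adj to P′; scale-monic to d′-monic; adj-degree to P′-degree;
     adj-right to P′-right; adj-left to P′-left)

  a : Poly
  a = L fz fz

  b c u v : Vector Poly n
  b k = L fz (fs k)
  c i = L (fs i) fz
  u = b ᵥ· P′
  v = P′ ·ᵥ c

  s D : Poly
  s = b ⋅ v
  D = a *ₚ d′ +ₚ (-ₚ s)

  P : Mat Poly (suc n)
  P fz     fz     = d′ *ₚ d′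
  P fz     (fs j) = (-ₚ d′) *ₚ u j
  P (fs i) fz     = (-ₚ d′) *ₚ v i
  P (fs i) (fs j) = P′ i j *ₚ D +ₚ v i *ₚ u j

  minor-·ᵥ-v : ∀ i → (minor L ·ᵥ v) i ≈ₚ d′ *ₚ c i
  minor-·ᵥ-v i = begin
    minor L i ⋅ (P′ ·ᵥ c)        ≈⟨ ≈ₚ-sym (⋅-assoc (minor L i) P′ c) ⟩
    (minor L i ᵥ· P′) ⋅ c        ≈⟨ ⋅-cong (P′-right i) (λ _ → ≈ₚ-refl) ⟩
    (scalarₘ d′ ·ᵥ c) i          ≈⟨ scalarₘ-·ᵥ d′ c i ⟩
    d′ *ₚ c i                    ∎

  u-ᵥ·-minor : ∀ j → (u ᵥ· minor L) j ≈ₚ b j *ₚ d′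
  u-ᵥ·-minor j = begin
    (b ᵥ· P′) ⋅ (λ k → minor L k j)     ≈⟨ ⋅-assoc b P′ (λ k → minor L k j) ⟩
    b ⋅ (λ k → (P′ ·ₘ minor L) k j)     ≈⟨ ⋅-congʳ b (λ k → P′-left k j) ⟩
    (b ᵥ· scalarₘ d′) j                 ≈⟨ ᵥ·-scalarₘ d′ b j ⟩
    b j *ₚ d′                           ∎

  u⋅c≈s : u ⋅ c ≈ₚ s
  u⋅c≈s = ⋅-assoc b P′ c

  right : L ·ₘ P ≈ₘ scalarₘ (d′ *ₚ D)
  right fz fz = ≈ₚ-trans (+-cong ≈ₚ-refl (⋅-*ʳ b v (-ₚ d′)))
    (solve 3 (λ a d s → a ⊗ (d ⊗ d) ⊕ ⊝ d ⊗ s ⊜ d ⊗ (a ⊗ d ⊕ ⊝ s)) ≈ₚ-refl a d′ s)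
  right fz (fs j) = ≈ₚ-trans (+-cong ≈ₚ-refl (⋅-linearʳ b (λ k → P′ k j) v D (u j)))
    (solve 4 (λ a d s u → a ⊗ (⊝ d ⊗ u) ⊕ (u ⊗ (a ⊗ d ⊕ ⊝ s) ⊕ s ⊗ u) ⊜ Κ []) ≈ₚ-refl a d′ s (u j))
  right (fs i) fz = ≈ₚ-trans (+-cong ≈ₚ-refl (≈ₚ-trans (⋅-*ʳ (minor L i) v (-ₚ d′)) (*-congʳ (-ₚ d′) (minor-·ᵥ-v i))))
    (solve 2 (λ c d → c ⊗ (d ⊗ d) ⊕ ⊝ d ⊗ (d ⊗ c) ⊜ Κ []) ≈ₚ-refl (c i) d′)
  right (fs i) (fs j) = begin
    c i *ₚ ((-ₚ d′) *ₚ u j) +ₚ minor L i ⋅ (λ k → P′ k j *ₚ D +ₚ v k *ₚ u j)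
      ≈⟨ +-cong (≈ₚ-refl {corner}) (⋅-linearʳ (minor L i) (λ k → P′ k j) v D (u j)) ⟩
    c i *ₚ ((-ₚ d′) *ₚ u j) +ₚ ((minor L ·ₘ P′) i j *ₚ D +ₚ (minor L ·ᵥ v) i *ₚ u j)
      ≈⟨ +-cong (≈ₚ-refl {corner}) (+-cong (*-congˡ D (P′-right i j)) (*-congˡ (u j) (minor-·ᵥ-v i))) ⟩
    c i *ₚ ((-ₚ d′) *ₚ u j) +ₚ (scalarₘ d′ i j *ₚ D +ₚ (d′ *ₚ c i) *ₚ u j)
      ≈⟨ solve 4 (λ c d u t → c ⊗ (⊝ d ⊗ u) ⊕ (t ⊕ d ⊗ c ⊗ u) ⊜ t) ≈ₚ-refl (c i) d′ (u j) (scalarₘ d′ i j *ₚ D) ⟩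
    scalarₘ d′ i j *ₚ D
      ≈⟨ scalarₘ-*ʳ d′ D i j ⟩
    scalarₘ (d′ *ₚ D) i j
      ∎
    where corner = c i *ₚ ((-ₚ d′) *ₚ u j)

  left : P ·ₘ L ≈ₘ scalarₘ (d′ *ₚ D)
  left fz fz = ≈ₚ-trans (+-cong ≈ₚ-refl (≈ₚ-trans (*-⋅ u c (-ₚ d′)) (*-congʳ (-ₚ d′) u⋅c≈s)))
    (solve 3 (λ a d s → d ⊗ d ⊗ a ⊕ ⊝ d ⊗ s ⊜ d ⊗ (a ⊗ d ⊕ ⊝ s)) ≈ₚ-refl a d′ s)
  left fz (fs j) = ≈ₚ-trans (+-cong ≈ₚ-refl (≈ₚ-trans (*-⋅ u (λ k → minor L k j) (-ₚ d′)) (*-congʳ (-ₚ d′) (u-ᵥ·-minor j))))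
    (solve 2 (λ b d → d ⊗ d ⊗ b ⊕ ⊝ d ⊗ (b ⊗ d) ⊜ Κ []) ≈ₚ-refl (b j) d′)
  left (fs i) fz = ≈ₚ-trans (+-cong ≈ₚ-refl (≈ₚ-trans (⋅-linearˡ c (P′ i) u D (v i)) (+-cong ≈ₚ-refl (*-congʳ (v i) u⋅c≈s))))
    (solve 4 (λ a d s v → ⊝ d ⊗ v ⊗ a ⊕ (v ⊗ (a ⊗ d ⊕ ⊝ s) ⊕ v ⊗ s) ⊜ Κ []) ≈ₚ-refl a d′ s (v i))
  left (fs i) (fs j) = begin
    (-ₚ d′) *ₚ v i *ₚ b j +ₚ (λ k → P′ i k *ₚ D +ₚ v i *ₚ u k) ⋅ (λ k → minor L k j)
      ≈⟨ +-cong (≈ₚ-refl {corner}) (⋅-linearˡ (λ k → minor L k j) (P′ i) u D (v i)) ⟩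
    (-ₚ d′) *ₚ v i *ₚ b j +ₚ ((P′ ·ₘ minor L) i j *ₚ D +ₚ v i *ₚ (u ᵥ· minor L) j)
      ≈⟨ +-cong (≈ₚ-refl {corner}) (+-cong (*-congˡ D (P′-left i j)) (*-congʳ (v i) (u-ᵥ·-minor j))) ⟩
    (-ₚ d′) *ₚ v i *ₚ b j +ₚ (scalarₘ d′ i j *ₚ D +ₚ v i *ₚ (b j *ₚ d′))
      ≈⟨ solve 4 (λ b d v t → ⊝ d ⊗ v ⊗ b ⊕ (t ⊕ v ⊗ (b ⊗ d)) ⊜ t) ≈ₚ-refl (b j) d′ (v i) (scalarₘ d′ i j *ₚ D) ⟩
    scalarₘ d′ i j *ₚ D
      ≈⟨ scalarₘ-*ʳ d′ D i j ⟩
    scalarₘ (d′ *ₚ D) i j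
      ∎
    where corner = (-ₚ d′) *ₚ v i *ₚ b j

  b-degree : ∀ k → DegreeBelow 1 (b k)
  b-degree k = offDiagonal χ λ ()

  c-degree : ∀ i → DegreeBelow 1 (c i)
  c-degree i = offDiagonal χ λ ()

  u-degree : ∀ j → DegreeBelow m′ (u j)
  u-degree j = degreeBelow-sum _ λ k → degreeBelow-*-constˡ (b k) (P′ k j) (b-degree k) (P′-degree k j)

  v-degree : ∀ i → DegreeBelow m′ (v i)
  v-degree i = degreeBelow-sum _ λ k → degreeBelow-*-constʳ (P′ i k) (c k) (P′-degree i k) (c-degree k)

  D-monic : Monic (suc m′) D
  D-monic = monic-sub (monic-* (diagonal χ fz) d′-monic)
                      (degreeBelow-mono (ℕP.n≤1+n m′) (degreeBelow-sum _ λ k →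
                         degreeBelow-*-constˡ (b k) (v k) (b-degree k) (v-degree k)))

  m : ℕ
  m = m′ + suc m′

  degreeBelow-m : ∀ {p q} → DegreeBelow (suc m′) p → DegreeBelow (suc m′) q → DegreeBelow m (p *ₚ q)
  degreeBelow-m {p} {q} dp dq = degreeBelow-mono (ℕP.≤-reflexive (sym (ℕP.+-suc m′ m′))) (degreeBelow-* p q dp dq)

  P-degree : ∀ i j → DegreeBelow m (P i j)
  P-degree fz     fz     = degreeBelow-m (proj₂ d′-monic) (proj₂ d′-monic)
  P-degree fz     (fs j) = degreeBelow-m (degreeBelow-scale _ d′ (proj₂ d′-monic)) (degreeBelow-mono (ℕP.n≤1+n m′) (u-degree j))
  P-degree (fs i) fz     = degreeBelow-m (degreeBelow-scale _ d′ (proj₂ d′-monic)) (degreeBelow-mono (ℕP.n≤1+n m′) (v-degree i))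
  P-degree (fs i) (fs j) = degreeBelow-+ (degreeBelow-* (P′ i j) D (P′-degree i j) (proj₂ D-monic))
    (degreeBelow-m (degreeBelow-mono (ℕP.n≤1+n m′) (v-degree i)) (degreeBelow-mono (ℕP.n≤1+n m′) (u-degree j)))

  scaledInverse : ScaledInverse L
  scaledInverse = record
    { degree = m ; scale = d′ *ₚ D ; adj = P ; scale-monic = monic-* d′-monic D-monic
    ; adj-degree = P-degree ; adj-right = right ; adj-left = left }

scaledInverse : ∀ {n} (L : Mat Poly n) → Characteristic L → ScaledInverse L
scaledInverse {zero}  L χ = record
  { degree = 0 ; scale = one ; adj = λ () ; scale-monic = refl , degreeBelow λ { (suc j) _ → refl }
  ; adj-degree = λ () ; adj-right = λ () ; adj-left = λ () }
scaledInverse {suc n} L χ = Bordering.scaledInverse L χ (scaledInverse (minor L) (characteristic-minor χ))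

sum-adj-solution : ∀ {n} {L : Mat Poly n} (I : ScaledInverse L) (y : Vector Poly n) e →
                   (∀ k → (L ·ᵥ y) k ≈ₚ e) →
                   sum (λ i → sum (ScaledInverse.adj I i)) *ₚ e ≈ₚ ScaledInverse.scale I *ₚ sum y
sum-adj-solution {L = L} I y e Ly≈e = begin
  sum (λ i → sum (adj i)) *ₚ e              ≈⟨ *-distribʳ-sum e (λ i → sum (adj i)) ⟩
  sum (λ i → sum (adj i) *ₚ e)              ≈⟨ sum-cong-≋ (λ i → *-distribʳ-sum e (adj i)) ⟩
  sum (λ i → adj i ⋅ λ _ → e)               ≈⟨ sum-cong-≋ (λ i → ⋅-congʳ (adj i) λ k → ≈ₚ-sym (Ly≈e k)) ⟩
  sum (λ i → adj i ⋅ (L ·ᵥ y))              ≈⟨ sum-cong-≋ (λ i → ≈ₚ-sym (⋅-assoc (adj i) L y)) ⟩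
  sum (λ i → (adj i ᵥ· L) ⋅ y)              ≈⟨ sum-cong-≋ (λ i → ⋅-cong (adj-left i) λ _ → ≈ₚ-refl) ⟩
  sum (λ i → (scalarₘ scale ·ᵥ y) i)        ≈⟨ sum-cong-≋ (scalarₘ-·ᵥ scale y) ⟩
  sum (λ i → scale *ₚ y i)                  ≈⟨ ≈ₚ-sym (*-distribˡ-sum scale y) ⟩
  scale *ₚ sum y                            ∎
  where open ScaledInverse I

λI-ₚ_ : ∀ {n} → Mat ℤ n → Mat Poly n
(λI-ₚ M) i j = (if δ i j then X else []) +ₚ C (- M i j)

δ-refl : ∀ {n} (i : Fin n) → δ i i ≡ true
δ-refl i with i ≟ i
... | yes _   = refl
... | no  i≢i = contradiction refl i≢i

δ-≢ : ∀ {n} {i j : Fin n} → i ≢ j → δ i j ≡ false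
δ-≢ {i = i} {j} i≢j with i ≟ j
... | yes i≡j = contradiction i≡j i≢j
... | no  _   = refl

δ-suc : ∀ {n} (i j : Fin n) → δ (fs i) (fs j) ≡ δ i j
δ-suc i j with i ≟ j
... | yes refl = refl
... | no  _    = refl

scalarₘ-δ : ∀ {n} d (i j : Fin n) → scalarₘ d i j ≡ (if δ i j then d else [])
scalarₘ-δ d fz     fz     = refl
scalarₘ-δ d fz     (fs j) = refl
scalarₘ-δ d (fs i) fz     = refl
scalarₘ-δ d (fs i) (fs j) = trans (scalarₘ-δ d i j) (cong (λ b → if b then d else []) (sym (δ-suc i j)))

λI-ₚ-characteristic : ∀ {n} (M : Mat ℤ n) → Characteristic (λI-ₚ M)
λI-ₚ-characteristic M = record
  { diagonal    = λ i → monic-cong (≡⇒≈ₚ (cong (λ b → (if b then X else []) +ₚ C (- M i i)) (sym (δ-refl i))))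
                                   (monic-+ X-monic (degreeBelow-const (- M i i)))
  ; offDiagonal = λ {i} {j} i≢j → degreeBelow-cong (≡⇒≈ₚ (cong (λ b → (if b then X else []) +ₚ C (- M i j)) (sym (δ-≢ i≢j))))
                                                 (degreeBelow-const (- M i j)) }

infix 4 _∼_
record _∼_ (f g : RatFun) : Set where
  constructor cross
  field cross-≈ : num f *ₚ den g ≈ₚ num g *ₚ den f
open _∼_

∼⇒≈ᶠ : ∀ {f g} → f ∼ g → f ≈ᶠ g
∼⇒≈ᶠ {f} {g} (cross f∼g) = ≈[]⇒IsZeroₚ (≈ₚ-trans (+-cong f∼g ≈ₚ-refl) (-‿inverseʳ (num g *ₚ den f)))

∼-trans : ∀ {f g h m} → Monic m (den g) → f ∼ g → g ∼ h → f ∼ h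
∼-trans {p / q} {p′ / q′} {p″ / q″} q′-monic (cross f∼g) (cross g∼h) = cross (monic-cancelʳ (p *ₚ q″) (p″ *ₚ q) q′-monic (begin
  p *ₚ q″ *ₚ q′       ≈⟨ solve 3 (λ p q″ q′ → p ⊗ q″ ⊗ q′ ⊜ q″ ⊗ (p ⊗ q′)) ≈ₚ-refl p q″ q′ ⟩
  q″ *ₚ (p *ₚ q′)     ≈⟨ *-congʳ q″ f∼g ⟩
  q″ *ₚ (p′ *ₚ q)     ≈⟨ solve 3 (λ q″ p′ q → q″ ⊗ (p′ ⊗ q) ⊜ q ⊗ (p′ ⊗ q″)) ≈ₚ-refl q″ p′ q ⟩
  q *ₚ (p′ *ₚ q″)     ≈⟨ *-congʳ q g∼h ⟩
  q *ₚ (p″ *ₚ q′)     ≈⟨ solve 3 (λ q p″ q′ → q ⊗ (p″ ⊗ q′) ⊜ p″ ⊗ q ⊗ q′) ≈ₚ-refl q p″ q′ ⟩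
  p″ *ₚ q *ₚ q′       ∎))

record Represents (f : RatFun) (p : Poly) : Set where
  constructor represents
  field
    num-≈ : num f ≈ₚ p
    den-≈ : den f ≈ₚ one

represents-cong : ∀ {f p q} → p ≈ₚ q → Represents f p → Represents f q
represents-cong p≈q (represents num≈p den≈1) = represents (≈ₚ-trans num≈p p≈q) den≈1

represents-int : ∀ a → Represents (intF a) (C a)
represents-int a = represents ≈ₚ-refl ≈ₚ-refl

represents-λ : Represents λF X
represents-λ = represents ≈ₚ-refl ≈ₚ-refl

represents-+ : ∀ {f g p q} → Represents f p → Represents g q → Represents (f +ᶠ g) (p +ₚ q)
represents-+ {p = p} {q} (represents nf df) (represents ng dg) =
  represents (+-cong (≈ₚ-trans (*-cong nf dg) (*-identityʳ p)) (≈ₚ-trans (*-cong ng df) (*-identityʳ q)))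
             (≈ₚ-trans (*-cong df dg) (*-identityʳ one))

represents-* : ∀ {f g p q} → Represents f p → Represents g q → Represents (f *ᶠ g) (p *ₚ q)
represents-* (represents nf df) (represents ng dg) = represents (*-cong nf ng) (≈ₚ-trans (*-cong df dg) (*-identityʳ one))

represents-neg : ∀ {f p} → Represents f p → Represents (-ᶠ f) (-ₚ p)
represents-neg (represents nf df) = represents (-‿cong nf) df

represents-÷ : ∀ {f g p q} → Represents f p → Represents g q → (p / q) ∼ (f ÷ᶠ g)
represents-÷ {f} {g} {p} {q} (represents nf df) (represents ng dg) = cross (begin
  p *ₚ (den f *ₚ num g)      ≈⟨ *-congʳ p (≈ₚ-trans (*-cong df ng) (*-identityˡ q)) ⟩
  p *ₚ q                     ≈⟨ *-congˡ q (≈ₚ-sym (≈ₚ-trans (*-cong nf dg) (*-identityʳ p))) ⟩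
  num f *ₚ den g *ₚ q        ∎)

represents-λI- : ∀ {n} (M : Mat ℤ n) i j → Represents ((λI- M) i j) ((λI-ₚ M) i j)
represents-λI- M i j with δ i j
... | true  = represents-+ represents-λ (represents-int (- M i j))
... | false = represents-cong (∷-cong (ℤP.+-identityˡ (- M i j)) ≈ₚ-refl)
                              (represents-+ (represents-int (+ 0)) (represents-int (- M i j)))

sum-/ : ∀ {n} (t : Vector RatFun n) (x : Vector Poly n) d →
        (∀ k → t k ∼ (x k / d)) → sumFin _+ᶠ_ (natF 0) n t ∼ (sum x / d)
sum-/ {zero}  t x d _   = cross (+-cong (scale-zero d) shift-[])
sum-/ {suc n} t x d t∼x = cross (begin
  (p₀ *ₚ q +ₚ p *ₚ q₀) *ₚ d
    ≈⟨ solve 5 (λ p₀ q p q₀ d → (p₀ ⊗ q ⊕ p ⊗ q₀) ⊗ d ⊜ (p₀ ⊗ d ⊗ q ⊕ p ⊗ d ⊗ q₀)) ≈ₚ-refl p₀ q p q₀ d ⟩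
  p₀ *ₚ d *ₚ q +ₚ p *ₚ d *ₚ q₀
    ≈⟨ +-cong (*-congˡ q (cross-≈ (t∼x fz))) (*-congˡ q₀ (cross-≈ tail∼)) ⟩
  x fz *ₚ q₀ *ₚ q +ₚ Σx *ₚ q *ₚ q₀
    ≈⟨ solve 4 (λ x₀ q₀ q Σx → x₀ ⊗ q₀ ⊗ q ⊕ Σx ⊗ q ⊗ q₀ ⊜ (x₀ ⊕ Σx) ⊗ (q₀ ⊗ q)) ≈ₚ-refl (x fz) q₀ q Σx ⟩
  (x fz +ₚ Σx) *ₚ (q₀ *ₚ q)
    ∎)
  where
  p₀ q₀ p q Σx : Poly
  p₀ = num (t fz)
  q₀ = den (t fz)
  p  = num (sumFin _+ᶠ_ (natF 0) n (λ k → t (fs k)))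
  q  = den (sumFin _+ᶠ_ (natF 0) n (λ k → t (fs k)))
  Σx = sum (λ k → x (fs k))
  tail∼ : sumFin _+ᶠ_ (natF 0) n (λ k → t (fs k)) ∼ (Σx / d)
  tail∼ = sum-/ (λ k → t (fs k)) (λ k → x (fs k)) d λ k → t∼x (fs k)

represents-*ᶠ-/ : ∀ {f p} q d → Represents f p → (f *ᶠ (q / d)) ∼ ((p *ₚ q) / d)
represents-*ᶠ-/ {f} {p} q d (represents nf df) = cross (begin
  num f *ₚ q *ₚ d          ≈⟨ *-congˡ d (*-congˡ q nf) ⟩
  p *ₚ q *ₚ d              ≈⟨ *-congʳ (p *ₚ q) (≈ₚ-sym (≈ₚ-trans (*-congˡ d df) (*-identityˡ d))) ⟩
  p *ₚ q *ₚ (den f *ₚ d)   ∎)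

/-*ᶠ-represents : ∀ {f p} q d → Represents f p → ((q / d) *ᶠ f) ∼ ((q *ₚ p) / d)
/-*ᶠ-represents {f} {p} q d (represents nf df) = cross (begin
  q *ₚ num f *ₚ d          ≈⟨ *-congˡ d (*-congʳ q nf) ⟩
  q *ₚ p *ₚ d              ≈⟨ *-congʳ (q *ₚ p) (≈ₚ-sym (≈ₚ-trans (*-congʳ d df) (*-identityʳ d))) ⟩
  q *ₚ p *ₚ (d *ₚ den f)   ∎)

scalarₘ-/∼Iᶠ : ∀ {n} {x} d (i j : Fin n) → x ≈ₚ scalarₘ d i j → (x / d) ∼ Iᶠ i j
scalarₘ-/∼Iᶠ {x = x} d i j x≈dI with δ i j | scalarₘ-δ d i j
... | true  | dI≡d  = cross $ ≈ₚ-trans (*-identityʳ x) (≈ₚ-trans x≈dI (≈ₚ-trans (≡⇒≈ₚ dI≡d) (≈ₚ-sym (*-identityˡ d))))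
... | false | dI≡[] = cross $ ≈ₚ-trans (*-identityʳ x) (≈ₚ-trans x≈dI (≈ₚ-trans (≡⇒≈ₚ dI≡[]) (≈ₚ-sym (C-zero d))))

module _ {n} (M : Mat ℤ n) where
  private
    I : ScaledInverse (λI-ₚ M)
    I = scaledInverse (λI-ₚ M) (λI-ₚ-characteristic M)
  open ScaledInverse I

  private
    N : Mat RatFun n
    N i j = adj i j / scale

  λI-inverse : IsInverse (λI- M) N
  λI-inverse = (λ _ _ → monic⇒nonzero scale-monic) , right , left
    where
    right : ((λI- M) ·ᶠ N) ≈ᴹ Iᶠ
    right i j = ∼⇒≈ᶠ (∼-trans scale-monic
      (sum-/ _ (λ k → (λI-ₚ M) i k *ₚ adj k j) scale λ k → represents-*ᶠ-/ (adj k j) scale (represents-λI- M i k))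
      (scalarₘ-/∼Iᶠ scale i j (adj-right i j)))
    left : (N ·ᶠ (λI- M)) ≈ᴹ Iᶠ
    left i j = ∼⇒≈ᶠ (∼-trans scale-monic
      (sum-/ _ (λ k → adj i k *ₚ (λI-ₚ M) k j) scale λ k → /-*ᶠ-represents (adj i k) scale (represents-λI- M k j))
      (scalarₘ-/∼Iᶠ scale i j (adj-left i j)))

  coronal-solution : ∀ (y : Vector Poly n) {m e F E} → Monic m e → (∀ k → ((λI-ₚ M) ·ᵥ y) k ≈ₚ e) →
                     Represents F (sum y) → Represents E e → CoronalIs M (F ÷ᶠ E)
  coronal-solution y {e = e} e-monic Ly≈e F≅Σy E≅e = N , λI-inverse , ∼⇒≈ᶠ
    (∼-trans scale-monic (sum-/ _ (λ i → sum (adj i)) scale λ i → sum-/ _ (adj i) scale λ j → cross ≈ₚ-refl)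
    (∼-trans e-monic (cross (≈ₚ-trans (sum-adj-solution I y e Ly≈e) (*-comm scale (sum y))))
    (represents-÷ F≅Σy E≅e)))

constₘ : ∀ {n} → Mat ℤ n → Mat Poly n
constₘ M i j = C (M i j)

sum-neg : ∀ {n} (x : Vector Poly n) → sum (λ i → -ₚ x i) ≈ₚ -ₚ sum x
sum-neg x = begin
  sum (λ i → -ₚ x i)             ≈⟨ sum-cong-≋ (λ i → solve 1 (λ x → ⊝ x ⊜ ⊝ Κ one ⊗ x) ≈ₚ-refl (x i)) ⟩
  sum (λ i → (-ₚ one) *ₚ x i)    ≈⟨ ≈ₚ-sym (*-distribˡ-sum (-ₚ one) x) ⟩
  (-ₚ one) *ₚ sum x              ≈⟨ solve 1 (λ s → ⊝ Κ one ⊗ s ⊜ ⊝ s) ≈ₚ-refl (sum x) ⟩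
  -ₚ sum x                       ∎

λI-ₚ-·ᵥ : ∀ {n} (M : Mat ℤ n) y k → ((λI-ₚ M) ·ᵥ y) k ≈ₚ X *ₚ y k +ₚ (-ₚ (constₘ M ·ᵥ y) k)
λI-ₚ-·ᵥ M y k = begin
  sum (λ j → ((if δ k j then X else []) +ₚ C (- M k j)) *ₚ y j)
    ≈⟨ sum-cong-≋ (λ j → *-distribʳ (y j) (if δ k j then X else []) (C (- M k j))) ⟩
  sum (λ j → (if δ k j then X else []) *ₚ y j +ₚ C (- M k j) *ₚ y j)
    ≈⟨ ∑-distrib-+ (λ j → (if δ k j then X else []) *ₚ y j) (λ j → C (- M k j) *ₚ y j) ⟩
  sum (λ j → (if δ k j then X else []) *ₚ y j) +ₚ sum (λ j → C (- M k j) *ₚ y j)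
    ≈⟨ +-cong (≈ₚ-trans (sum-cong-≋ λ j → *-congˡ (y j) (≡⇒≈ₚ (sym (scalarₘ-δ X k j)))) (scalarₘ-·ᵥ X y k))
              (≈ₚ-trans (sum-cong-≋ λ j → ≈ₚ-trans (*-congˡ (y j) (C-neg (M k j)))
                                          (solve 2 (λ c y → ⊝ c ⊗ y ⊜ ⊝ (c ⊗ y)) ≈ₚ-refl (C (M k j)) (y j)))
                        (sum-neg (λ j → C (M k j) *ₚ y j))) ⟩
  X *ₚ y k +ₚ (-ₚ (constₘ M ·ᵥ y) k)
    ∎

onSides : ∀ {n} → (Fin n → Bool) → Poly → Poly → Vector Poly n
onSides side Y₁ Y₂ i = if side i then Y₁ else Y₂

sum-indicator : ∀ {n} (p : Fin n → Bool) → sum (λ i → C (if p i then + 1 else + 0)) ≈ₚ C (+ count p)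
sum-indicator {zero}  p = ≈ₚ-sym shift-[]
sum-indicator {suc n} p = +-cong (C-indicator (p fz)) (sum-indicator (λ i → p (fs i)))
  where
  C-indicator : ∀ b → C (if b then + 1 else + 0) ≈ₚ C (+ (if b then 1 else 0))
  C-indicator true  = ≈ₚ-refl
  C-indicator false = ≈ₚ-refl

sum-onSides : ∀ {n} (side : Fin n → Bool) Y₁ Y₂ →
              sum (onSides side Y₁ Y₂) ≈ₚ C (+ count side) *ₚ Y₁ +ₚ C (+ count (λ i → not (side i))) *ₚ Y₂
sum-onSides side Y₁ Y₂ = begin
  sum (onSides side Y₁ Y₂)
    ≈⟨ sum-cong-≋ (λ i → split (side i)) ⟩
  sum (λ i → ind (side i) *ₚ Y₁ +ₚ ind (not (side i)) *ₚ Y₂)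
    ≈⟨ ∑-distrib-+ (λ i → ind (side i) *ₚ Y₁) (λ i → ind (not (side i)) *ₚ Y₂) ⟩
  sum (λ i → ind (side i) *ₚ Y₁) +ₚ sum (λ i → ind (not (side i)) *ₚ Y₂)
    ≈⟨ ≈ₚ-sym (+-cong (*-distribʳ-sum Y₁ (λ i → ind (side i))) (*-distribʳ-sum Y₂ (λ i → ind (not (side i))))) ⟩
  sum (λ i → ind (side i)) *ₚ Y₁ +ₚ sum (λ i → ind (not (side i))) *ₚ Y₂
    ≈⟨ +-cong (*-congˡ Y₁ (sum-indicator side)) (*-congˡ Y₂ (sum-indicator (λ i → not (side i)))) ⟩
  C (+ count side) *ₚ Y₁ +ₚ C (+ count (λ i → not (side i))) *ₚ Y₂
    ∎
  where
  ind : Bool → Poly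
  ind b = C (if b then + 1 else + 0)
  split : ∀ b → (if b then Y₁ else Y₂) ≈ₚ ind b *ₚ Y₁ +ₚ ind (not b) *ₚ Y₂
  split true  = ≈ₚ-sym (≈ₚ-trans (+-cong (*-identityˡ Y₁) (C-zero Y₂)) (+-identityʳ Y₁))
  split false = ≈ₚ-sym (+-cong (C-zero Y₁) (*-identityˡ Y₂))

onSides-≈ : ∀ {n} (side : Fin n → Bool) {E₁ E₂ e} → E₁ ≈ₚ e → E₂ ≈ₚ e → ∀ k → onSides side E₁ E₂ k ≈ₚ e
onSides-≈ side E₁≈e E₂≈e k with side k
... | true  = E₁≈e
... | false = E₂≈e

module _ {n} (D : SimpleDigraph n) {side : Fin n → Bool} (bipartite : IsBipartition D side) (Y₁ Y₂ : Poly) where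

  adjMat-·ᵥ-onSides : ∀ k → (constₘ (adjMat D) ·ᵥ onSides side Y₁ Y₂) k ≈ₚ C (+ outdeg D k) *ₚ onSides side Y₂ Y₁ k
  adjMat-·ᵥ-onSides k = begin
    sum (λ j → C (adjMat D k j) *ₚ onSides side Y₁ Y₂ j)   ≈⟨ sum-cong-≋ across ⟩
    sum (λ j → C (adjMat D k j) *ₚ onSides side Y₂ Y₁ k)   ≈⟨ ≈ₚ-sym (*-distribʳ-sum _ (λ j → C (adjMat D k j))) ⟩
    sum (λ j → C (adjMat D k j)) *ₚ onSides side Y₂ Y₁ k   ≈⟨ *-congˡ _ (sum-indicator (arc D k)) ⟩
    C (+ outdeg D k) *ₚ onSides side Y₂ Y₁ k               ∎
    where
    across : ∀ j → C (adjMat D k j) *ₚ onSides side Y₁ Y₂ j ≈ₚ C (adjMat D k j) *ₚ onSides side Y₂ Y₁ k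
    across j with arc D k j in k→j
    ... | false = ≈ₚ-trans (C-zero _) (≈ₚ-sym (C-zero _))
    ... | true with side k in sk | side j in sj
    ...   | true  | true  = ⊥-elim (bipartite k j k→j (trans sk (sym sj)))
    ...   | true  | false = ≈ₚ-refl
    ...   | false | true  = ≈ₚ-refl
    ...   | false | false = ⊥-elim (bipartite k j k→j (trans sk (sym sj)))

  QMat-·ᵥ-onSides : ∀ k → (constₘ (QMat D) ·ᵥ onSides side Y₁ Y₂) k ≈ₚ
                          C (+ outdeg D k) *ₚ onSides side Y₁ Y₂ k +ₚ C (+ outdeg D k) *ₚ onSides side Y₂ Y₁ k
  QMat-·ᵥ-onSides k = begin
    sum (λ j → (C (Dout j) +ₚ C (adjMat D k j)) *ₚ y j)
      ≈⟨ sum-cong-≋ (λ j → *-distribʳ (y j) (C (Dout j)) (C (adjMat D k j))) ⟩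
    sum (λ j → C (Dout j) *ₚ y j +ₚ C (adjMat D k j) *ₚ y j)
      ≈⟨ ∑-distrib-+ (λ j → C (Dout j) *ₚ y j) (λ j → C (adjMat D k j) *ₚ y j) ⟩
    sum (λ j → C (Dout j) *ₚ y j) +ₚ (constₘ (adjMat D) ·ᵥ y) k
      ≈⟨ +-cong (≈ₚ-trans (sum-cong-≋ onDiagonal) (scalarₘ-·ᵥ (C (+ outdeg D k)) y k)) (adjMat-·ᵥ-onSides k) ⟩
    C (+ outdeg D k) *ₚ y k +ₚ C (+ outdeg D k) *ₚ onSides side Y₂ Y₁ k
      ∎
    where
    y = onSides side Y₁ Y₂
    Dout : Fin n → ℤ
    Dout j = if δ k j then + outdeg D k else + 0
    onDiagonal : ∀ j → C (Dout j) *ₚ y j ≈ₚ scalarₘ (C (+ outdeg D k)) k j *ₚ y j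
    onDiagonal j rewrite scalarₘ-δ (C (+ outdeg D k)) k j with δ k j
    ... | true  = ≈ₚ-refl
    ... | false = C-zero (y j)

module SemiRegularBipartite {n} (D : SimpleDigraph n) {side : Fin n → Bool} {r₁ r₂ : ℕ}
                            (bipartite : IsBipartition D side) (regular : SemiRegular D side r₁ r₂) where

  R₁ R₂ N₁ N₂ : Poly
  R₁ = C (+ r₁)
  R₂ = C (+ r₂)
  N₁ = C (+ count side)
  N₂ = C (+ count (λ i → not (side i)))

  outdeg-onSides : ∀ k → C (+ outdeg D k) ≡ onSides side R₁ R₂ k
  outdeg-onSides k with side k in sk
  ... | true  = cong (λ r → C (+ r)) (proj₁ regular k sk)
  ... | false = cong (λ r → C (+ r)) (proj₂ regular k sk)

  adjacency-row : ∀ Y₁ Y₂ k → ((λI-ₚ adjMat D) ·ᵥ onSides side Y₁ Y₂) k ≈ₚ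
                               onSides side (X *ₚ Y₁ +ₚ (-ₚ (R₁ *ₚ Y₂))) (X *ₚ Y₂ +ₚ (-ₚ (R₂ *ₚ Y₁))) k
  adjacency-row Y₁ Y₂ k = begin
    ((λI-ₚ adjMat D) ·ᵥ y) k
      ≈⟨ λI-ₚ-·ᵥ (adjMat D) y k ⟩
    X *ₚ y k +ₚ (-ₚ (constₘ (adjMat D) ·ᵥ y) k)
      ≈⟨ +-cong (≈ₚ-refl {X *ₚ y k}) (-‿cong (≈ₚ-trans (adjMat-·ᵥ-onSides D bipartite Y₁ Y₂ k)
                                                      (*-congˡ _ (≡⇒≈ₚ (outdeg-onSides k))))) ⟩
    X *ₚ y k +ₚ (-ₚ (onSides side R₁ R₂ k *ₚ onSides side Y₂ Y₁ k))
      ≡⟨ by-side (side k) ⟩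
    onSides side (X *ₚ Y₁ +ₚ (-ₚ (R₁ *ₚ Y₂))) (X *ₚ Y₂ +ₚ (-ₚ (R₂ *ₚ Y₁))) k
      ∎
    where
    y = onSides side Y₁ Y₂
    by-side : ∀ b → X *ₚ (if b then Y₁ else Y₂) +ₚ (-ₚ ((if b then R₁ else R₂) *ₚ (if b then Y₂ else Y₁)))
                    ≡ (if b then X *ₚ Y₁ +ₚ (-ₚ (R₁ *ₚ Y₂)) else X *ₚ Y₂ +ₚ (-ₚ (R₂ *ₚ Y₁)))
    by-side true  = refl
    by-side false = refl

  signlessLaplacian-row : ∀ Y₁ Y₂ k → ((λI-ₚ QMat D) ·ᵥ onSides side Y₁ Y₂) k ≈ₚ
      onSides side (X *ₚ Y₁ +ₚ (-ₚ (R₁ *ₚ Y₁ +ₚ R₁ *ₚ Y₂))) (X *ₚ Y₂ +ₚ (-ₚ (R₂ *ₚ Y₂ +ₚ R₂ *ₚ Y₁))) k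
  signlessLaplacian-row Y₁ Y₂ k = begin
    ((λI-ₚ QMat D) ·ᵥ y) k
      ≈⟨ λI-ₚ-·ᵥ (QMat D) y k ⟩
    X *ₚ y k +ₚ (-ₚ (constₘ (QMat D) ·ᵥ y) k)
      ≈⟨ +-cong (≈ₚ-refl {X *ₚ y k}) (-‿cong (≈ₚ-trans (QMat-·ᵥ-onSides D bipartite Y₁ Y₂ k)
                                                      (≡⇒≈ₚ (cong (λ r → r *ₚ y k +ₚ r *ₚ onSides side Y₂ Y₁ k) (outdeg-onSides k))))) ⟩
    X *ₚ y k +ₚ (-ₚ (onSides side R₁ R₂ k *ₚ y k +ₚ onSides side R₁ R₂ k *ₚ onSides side Y₂ Y₁ k))
      ≡⟨ by-side (side k) ⟩
    onSides side (X *ₚ Y₁ +ₚ (-ₚ (R₁ *ₚ Y₁ +ₚ R₁ *ₚ Y₂))) (X *ₚ Y₂ +ₚ (-ₚ (R₂ *ₚ Y₂ +ₚ R₂ *ₚ Y₁))) k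
      ∎
    where
    y = onSides side Y₁ Y₂
    by-side : ∀ b → X *ₚ (if b then Y₁ else Y₂) +ₚ (-ₚ ((if b then R₁ else R₂) *ₚ (if b then Y₁ else Y₂)
                                                   +ₚ (if b then R₁ else R₂) *ₚ (if b then Y₂ else Y₁)))
                    ≡ (if b then X *ₚ Y₁ +ₚ (-ₚ (R₁ *ₚ Y₁ +ₚ R₁ *ₚ Y₂)) else X *ₚ Y₂ +ₚ (-ₚ (R₂ *ₚ Y₂ +ₚ R₂ *ₚ Y₁)))
    by-side true  = refl
    by-side false = refl

  n₁ n₂ : ℕ
  n₁ = count side
  n₂ = count (λ i → not (side i))

  adjacency-coronal : CoronalIs (adjMat D)
    ((natF (n₁ + n₂) *ᶠ λF +ᶠ natF (n₁ * r₁ + n₂ * r₂)) ÷ᶠ (λF *ᶠ λF +ᶠ -ᶠ natF (r₁ * r₂)))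
  adjacency-coronal = coronal-solution (adjMat D) y
    (monic-sub (monic-* X-monic X-monic) (degreeBelow-mono (s≤s z≤n) (degreeBelow-const (+ (r₁ * r₂)))))
    (λ k → ≈ₚ-trans (adjacency-row Y₁ Y₂ k) (onSides-≈ side (row R₁ R₂ (≈ₚ-sym (C-ℕ-* r₁ r₂)))
                                                               (row R₂ R₁ (≈ₚ-trans (*-comm R₂ R₁) (≈ₚ-sym (C-ℕ-* r₁ r₂)))) k))
    (represents-cong Σy (represents-+ (represents-* (represents-int (+ (n₁ + n₂))) represents-λ)
                                     (represents-int (+ (n₁ * r₁ + n₂ * r₂)))))
    (represents-+ (represents-* represents-λ represents-λ) (represents-neg (represents-int (+ (r₁ * r₂)))))
    where
    Y₁ = X +ₚ R₁
    Y₂ = X +ₚ R₂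
    y = onSides side Y₁ Y₂
    row : ∀ R R′ → R *ₚ R′ ≈ₚ C (+ (r₁ * r₂)) →
          X *ₚ (X +ₚ R) +ₚ (-ₚ (R *ₚ (X +ₚ R′))) ≈ₚ X *ₚ X +ₚ (-ₚ C (+ (r₁ * r₂)))
    row R R′ RR′≈r₁r₂ = ≈ₚ-trans
      (solve 3 (λ x r r′ → x ⊗ (x ⊕ r) ⊕ ⊝ (r ⊗ (x ⊕ r′)) ⊜ (x ⊗ x ⊕ ⊝ (r ⊗ r′))) ≈ₚ-refl X R R′)
      (+-cong (≈ₚ-refl {X *ₚ X}) (-‿cong RR′≈r₁r₂))
    Σy : C (+ (n₁ + n₂)) *ₚ X +ₚ C (+ (n₁ * r₁ + n₂ * r₂)) ≈ₚ sum y
    Σy = begin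
      (N₁ +ₚ N₂) *ₚ X +ₚ (C (+ (n₁ * r₁)) +ₚ C (+ (n₂ * r₂)))
        ≈⟨ +-cong (≈ₚ-refl {(N₁ +ₚ N₂) *ₚ X}) (+-cong (C-ℕ-* n₁ r₁) (C-ℕ-* n₂ r₂)) ⟩
      (N₁ +ₚ N₂) *ₚ X +ₚ (N₁ *ₚ R₁ +ₚ N₂ *ₚ R₂)
        ≈⟨ solve 5 (λ x a b p q → (p ⊕ q) ⊗ x ⊕ (p ⊗ a ⊕ q ⊗ b) ⊜ (p ⊗ (x ⊕ a) ⊕ q ⊗ (x ⊕ b))) ≈ₚ-refl X R₁ R₂ N₁ N₂ ⟩
      N₁ *ₚ Y₁ +ₚ N₂ *ₚ Y₂
        ≈⟨ ≈ₚ-sym (sum-onSides side Y₁ Y₂) ⟩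
      sum y
        ∎

  signlessLaplacian-coronal : CoronalIs (QMat D)
    ((natF (n₁ + n₂) *ᶠ λF +ᶠ intF ((+ n₁ -ℤ + n₂) *ℤ (+ r₁ -ℤ + r₂))) ÷ᶠ (λF *ᶠ (λF +ᶠ -ᶠ natF (r₁ + r₂))))
  signlessLaplacian-coronal = coronal-solution (QMat D) z
    (monic-* X-monic (monic-sub X-monic (degreeBelow-const (+ (r₁ + r₂)))))
    (λ k → ≈ₚ-trans (signlessLaplacian-row Z₁ Z₂ k) (onSides-≈ side (row R₁ R₂ ≈ₚ-refl) (row R₂ R₁ (+-comm R₂ R₁)) k))
    (represents-cong Σz (represents-+ (represents-* (represents-int (+ (n₁ + n₂))) represents-λ)
                                     (represents-int ((+ n₁ -ℤ + n₂) *ℤ (+ r₁ -ℤ + r₂)))))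
    (represents-* represents-λ (represents-+ represents-λ (represents-neg (represents-int (+ (r₁ + r₂))))))
    where
    Z₁ = X +ₚ R₁ +ₚ (-ₚ R₂)
    Z₂ = X +ₚ R₂ +ₚ (-ₚ R₁)
    z = onSides side Z₁ Z₂
    row : ∀ R R′ → R +ₚ R′ ≈ₚ C (+ (r₁ + r₂)) →
          X *ₚ (X +ₚ R +ₚ (-ₚ R′)) +ₚ (-ₚ (R *ₚ (X +ₚ R +ₚ (-ₚ R′)) +ₚ R *ₚ (X +ₚ R′ +ₚ (-ₚ R))))
            ≈ₚ X *ₚ (X +ₚ (-ₚ C (+ (r₁ + r₂))))
    row R R′ R+R′≈r₁+r₂ = ≈ₚ-trans
      (solve 3 (λ x r r′ → x ⊗ (x ⊕ r ⊕ ⊝ r′) ⊕ ⊝ (r ⊗ (x ⊕ r ⊕ ⊝ r′) ⊕ r ⊗ (x ⊕ r′ ⊕ ⊝ r))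
                           ⊜ x ⊗ (x ⊕ ⊝ (r ⊕ r′)))
             ≈ₚ-refl X R R′)
      (*-congʳ X (+-cong (≈ₚ-refl {X}) (-‿cong R+R′≈r₁+r₂)))
    Σz : C (+ (n₁ + n₂)) *ₚ X +ₚ C ((+ n₁ -ℤ + n₂) *ℤ (+ r₁ -ℤ + r₂)) ≈ₚ sum z
    Σz = begin
      (N₁ +ₚ N₂) *ₚ X +ₚ C ((+ n₁ -ℤ + n₂) *ℤ (+ r₁ -ℤ + r₂))
        ≈⟨ +-cong (≈ₚ-refl {(N₁ +ₚ N₂) *ₚ X})
                  (≈ₚ-trans (C-* (+ n₁ -ℤ + n₂) (+ r₁ -ℤ + r₂)) (*-cong (C-sub (+ n₁) (+ n₂)) (C-sub (+ r₁) (+ r₂)))) ⟩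
      (N₁ +ₚ N₂) *ₚ X +ₚ (N₁ +ₚ (-ₚ N₂)) *ₚ (R₁ +ₚ (-ₚ R₂))
        ≈⟨ solve 5 (λ x a b p q → (p ⊕ q) ⊗ x ⊕ (p ⊕ ⊝ q) ⊗ (a ⊕ ⊝ b) ⊜ (p ⊗ (x ⊕ a ⊕ ⊝ b) ⊕ q ⊗ (x ⊕ b ⊕ ⊝ a)))
                 ≈ₚ-refl X R₁ R₂ N₁ N₂ ⟩
      N₁ *ₚ Z₁ +ₚ N₂ *ₚ Z₂
        ≈⟨ ≈ₚ-sym (sum-onSides side Z₁ Z₂) ⟩
      sum z
        ∎

proposition2p8 : (n : ℕ) (D : SimpleDigraph n) (side : Fin n → Bool) (r₁ r₂ : ℕ)
    → IsBipartition D side → SemiRegular D side r₁ r₂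
    → let n₁ = count side
          n₂ = count (λ i → not (side i))
      in CoronalIs (adjMat D)
           ((natF (n₁ + n₂) *ᶠ λF +ᶠ natF (n₁ * r₁ + n₂ * r₂))
              ÷ᶠ (λF *ᶠ λF +ᶠ -ᶠ natF (r₁ * r₂)))
         × CoronalIs (QMat D)
           ((natF (n₁ + n₂) *ᶠ λF +ᶠ intF ((+ n₁ -ℤ + n₂) *ℤ (+ r₁ -ℤ + r₂)))
              ÷ᶠ (λF *ᶠ (λF +ᶠ -ᶠ natF (r₁ + r₂))))
proposition2p8 n D side r₁ r₂ bipartite regular = adjacency-coronal , signlessLaplacian-coronal
  where open SemiRegularBipartite D bipartite regular
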